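{- Let $\Gamma\subset\mathbb{R}^E_{\ge0}$ be a finite nonempty family of usage vectors, each with at least one positive entry, and let $\widehat{\Gamma}$ be its Fulkerson blocker family. For every $\widehat{\gamma}\in\widehat{\Gamma}$ there exists $\sigma\in\mathbb{R}^E_{>0}$ such that $\widehat{\gamma}$ is the unique optimal solution of $\mathrm{Mod}_{1,\sigma}(\Gamma)$ and also the unique minimizer of $\sigma^T\gamma$ over $\gamma\in\widehat{\Gamma}$.
   Context: $E$ is a finite set. $\mathrm{Adm}(\Gamma)=\{\rho\in\mathbb{R}^E_{\ge0}:\gamma^T\rho\ge1\ \forall\gamma\in\Gamma\}$; the Fulkerson blocker family $\widehat\Gamma$ is the set of extreme points of $\mathrm{Adm}(\Gamma)$; $\mathrm{Mod}_{1,\sigma}(\Gamma)=\min_{\rho\in\mathrm{Adm}(\Gamma)}\sigma^T\rho$. -}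

module Defs where

open import Level using (Level; 0ℓ) renaming (suc to lsuc)
open import Data.Nat using (ℕ; zero; suc)
open import Data.Fin using (Fin; zero; suc)
open import Data.Product using (Σ; ∃; _×_; _,_)
open import Data.Sum using (_⊎_)
open import Relation.Binary.PropositionalEquality using (_≡_)
open import Relation.Nullary using (¬_)

-- An axiomatic presentation of the real numbers: a complete ordered field
-- (unique up to isomorphism).  The theorem is stated for any such structure.
record RealField : Set₁ where
  infixl 6 _+_
  infixl 7 _*_
  infix  4 _<_
  field
    ℝ     : Set
    0r 1r : ℝ
    _+_ _*_ : ℝ → ℝ → ℝ
    -_    : ℝ → ℝ
    inv   : (x : ℝ) → ¬ (x ≡ 0r) → ℝ
    _<_   : ℝ → ℝ → Set
    +-assoc  : ∀ x y z → (x + y) + z ≡ x + (y + z)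
    +-comm   : ∀ x y → x + y ≡ y + x
    +-idˡ    : ∀ x → 0r + x ≡ x
    +-invˡ   : ∀ x → (- x) + x ≡ 0r
    *-assoc  : ∀ x y z → (x * y) * z ≡ x * (y * z)
    *-comm   : ∀ x y → x * y ≡ y * x
    *-idˡ    : ∀ x → 1r * x ≡ x
    *-invˡ   : ∀ x (p : ¬ (x ≡ 0r)) → inv x p * x ≡ 1r
    distribˡ : ∀ x y z → x * (y + z) ≡ x * y + x * z
    0≢1      : ¬ (0r ≡ 1r)
    <-irrefl : ∀ x → ¬ (x < x)
    <-trans  : ∀ {x y z} → x < y → y < z → x < z
    <-tri    : ∀ x y → x < y ⊎ (x ≡ y ⊎ y < x)
    +-mono-< : ∀ {x y} z → x < y → x + z < y + z
    *-pos    : ∀ {x y} → 0r < x → 0r < y → 0r < x * y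

  _≤_ : ℝ → ℝ → Set
  x ≤ y = x < y ⊎ x ≡ y

  field
    lub : (P : ℝ → Set) → ∃ P → (∃ λ b → ∀ x → P x → x ≤ b) →
          ∃ λ s → (∀ x → P x → x ≤ s) × (∀ b → (∀ x → P x → x ≤ b) → s ≤ b)

module LP (R : RealField) where
  open RealField R

  -- vectors in ℝ^E with E = Fin n
  Vec : ℕ → Set
  Vec n = Fin n → ℝ

  sumF : ∀ {n} → (Fin n → ℝ) → ℝ
  sumF {zero}  f = 0r
  sumF {suc n} f = f zero + sumF (λ i → f (suc i))

  _·_ : ∀ {n} → Vec n → Vec n → ℝ
  a · b = sumF (λ e → a e * b e)

  _≐_ : ∀ {n} → Vec n → Vec n → Set
  a ≐ b = ∀ e → a e ≡ b e

  Nonneg : ∀ {n} → Vec n → Set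
  Nonneg v = ∀ e → 0r ≤ v e

  Positive : ∀ {n} → Vec n → Set
  Positive v = ∀ e → 0r < v e

  -- a family Γ given as a finite indexed list of usage vectors
  -- Adm(Γ) = { ρ ≥ 0 : γ^T ρ ≥ 1 for all γ ∈ Γ }
  Adm : ∀ {n m} → (Fin m → Vec n) → Vec n → Set
  Adm Γ ρ = Nonneg ρ × (∀ i → 1r ≤ (Γ i · ρ))

  comb : ∀ {n} → ℝ → Vec n → Vec n → Vec n
  comb t x y e = t * x e + (1r + (- t)) * y e

  Extreme : ∀ {n} → (Vec n → Set) → Vec n → Set
  Extreme S ρ = S ρ × (∀ x y t → S x → S y → 0r < t → t < 1r →
                        ρ ≐ comb t x y → x ≐ y)

  InBlocker : ∀ {n m} → (Fin m → Vec n) → Vec n → Set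
  InBlocker Γ = Extreme (Adm Γ)

{-# OPTIONS --safe #-}
-- Let T be the constraints tight at γ̂ (Γᵢ·γ̂ = 1), Z the coordinates where γ̂ vanishes, and
-- σ = Σ_{i∈T} Γᵢ + Σ_{e∈Z} 1ₑ. For admissible ρ, σ·ρ = Σ_{i∈T} Γᵢ·ρ + Σ_{e∈Z} ρₑ ≥ |T| = σ·γ̂, and
-- equality forces d = ρ − γ̂ to satisfy Γᵢ·d = 0 (i ∈ T) and dₑ = 0 (e ∈ Z). For such a d the points
-- γ̂ ± εd are admissible for small ε > 0 and have midpoint γ̂, so extremality gives d = 0. Applied to
-- d = 1ₑ the same argument shows σₑ > 0. Blocker elements are admissible, so minimality over Γ̂ is a
-- special case; the hypothesis that every Γᵢ has a positive entry is not needed.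
module Submission where

open import Defs
open import Level using (0ℓ)
open import Data.Bool using (if_then_else_)
open import Data.Nat using (ℕ; zero; suc)
open import Data.Fin using (Fin; zero; suc)
import Data.Fin.Properties as Fin
open import Data.Maybe using (nothing)
open import Data.Product using (∃; _×_; _,_; proj₁; proj₂)
open import Data.Sum using (inj₁; inj₂)
open import Data.Empty using (⊥-elim)
open import Relation.Nullary using (¬_; Dec; yes; no; does)
open import Relation.Binary.PropositionalEquality
open import Algebra.Bundles using (CommutativeRing)
open import Tactic.RingSolver.Core.AlmostCommutativeRing using (fromCommutativeRing)
import Algebra.Properties.Ring as RingProperties
import Tactic.RingSolver.NonReflective as RingSolver

module OrderedFieldProperties (R : RealField) where
  -- Defs declares no fixity for _≤_.
  open RealField R renaming (_≤_ to infix 4 _≤_)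

  commutativeRing : CommutativeRing 0ℓ 0ℓ
  commutativeRing = record
    { isCommutativeRing = record
      { isRing = record
        { +-isAbelianGroup = record
          { isGroup = record
            { isMonoid = record
              { isSemigroup = record
                { isMagma = record { isEquivalence = isEquivalence ; ∙-cong = cong₂ _+_ }
                ; assoc = +-assoc }
              ; identity = +-idˡ , λ x → trans (+-comm x 0r) (+-idˡ x) }
            ; inverse = +-invˡ , λ x → trans (+-comm x (- x)) (+-invˡ x)
            ; ⁻¹-cong = cong -_ }
          ; comm = +-comm }
        ; *-cong = cong₂ _*_
        ; *-assoc = *-assoc
        ; *-identity = *-idˡ , λ x → trans (*-comm x 1r) (*-idˡ x)
        ; distrib = distribˡ , λ x y z → trans (*-comm (y + z) x)
                      (trans (distribˡ x y z) (cong₂ _+_ (*-comm x y) (*-comm x z))) }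
      ; *-comm = *-comm } }

  open CommutativeRing commutativeRing public
    using (+-identityʳ; *-identityʳ; distribʳ; zeroˡ; zeroʳ)
    renaming (-‿inverseʳ to +-inverseʳ)
  open RingProperties (CommutativeRing.ring commutativeRing) public
    using (-‿distribˡ-*; -‿distribʳ-*; -‿involutive; -1*x≈-x; +-cancelˡ)
    renaming (x∙y⁻¹≈ε⇒x≈y to x-y≡0⇒x≡y)
  -- Without a zero test the solver cannot cancel x + - x; such steps are done by hand.
  open RingSolver (fromCommutativeRing commutativeRing (λ _ → nothing)) public
    using (solve; _⊜_; _⊕_; _⊗_)

  infix 4 _≟_
  _≟_ : (x y : ℝ) → Dec (x ≡ y)
  x ≟ y with <-tri x y
  ... | inj₁ x<y        = no λ { refl → <-irrefl x x<y }
  ... | inj₂ (inj₁ x≡y) = yes x≡y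
  ... | inj₂ (inj₂ y<x) = no λ { refl → <-irrefl x y<x }

  ≤-refl : ∀ {x} → x ≤ x
  ≤-refl = inj₂ refl

  <-≤-trans : ∀ {x y z} → x < y → y ≤ z → x < z
  <-≤-trans x<y (inj₁ y<z) = <-trans x<y y<z
  <-≤-trans x<y (inj₂ refl) = x<y

  ≤-trans : ∀ {x y z} → x ≤ y → y ≤ z → x ≤ z
  ≤-trans (inj₁ x<y) y≤z = inj₁ (<-≤-trans x<y y≤z)
  ≤-trans (inj₂ refl) y≤z = y≤z

  <⇒≢ : ∀ {x y} → x < y → x ≢ y
  <⇒≢ {x} x<y refl = <-irrefl x x<y

  <⇒≱ : ∀ {x y} → x < y → ¬ (y ≤ x)
  <⇒≱ {x} x<y (inj₁ y<x) = <-irrefl x (<-trans x<y y<x)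
  <⇒≱ x<y (inj₂ refl) = <⇒≢ x<y refl

  ≤-antisym : ∀ {x y} → x ≤ y → y ≤ x → x ≡ y
  ≤-antisym (inj₁ x<y) y≤x = ⊥-elim (<⇒≱ x<y y≤x)
  ≤-antisym (inj₂ x≡y) _ = x≡y

  +-monoˡ-< : ∀ {x y} z → x < y → z + x < z + y
  +-monoˡ-< {x} {y} z x<y = subst₂ _<_ (+-comm x z) (+-comm y z) (+-mono-< z x<y)

  +-monoʳ-≤ : ∀ {x y} z → x ≤ y → x + z ≤ y + z
  +-monoʳ-≤ z (inj₁ x<y) = inj₁ (+-mono-< z x<y)
  +-monoʳ-≤ z (inj₂ refl) = ≤-refl

  +-monoˡ-≤ : ∀ {x y} z → x ≤ y → z + x ≤ z + y
  +-monoˡ-≤ z (inj₁ x<y) = inj₁ (+-monoˡ-< z x<y)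
  +-monoˡ-≤ z (inj₂ refl) = ≤-refl

  +-mono-≤ : ∀ {a b c d} → a ≤ b → c ≤ d → a + c ≤ b + d
  +-mono-≤ {b = b} {c = c} a≤b c≤d = ≤-trans (+-monoʳ-≤ c a≤b) (+-monoˡ-≤ b c≤d)

  +-mono-≤-equality : ∀ {a b c d} → a ≤ b → c ≤ d → a + c ≡ b + d → a ≡ b × c ≡ d
  +-mono-≤-equality {b = b} {c = c} (inj₁ a<b) c≤d eq =
    ⊥-elim (<⇒≢ (<-≤-trans (+-mono-< c a<b) (+-monoˡ-≤ b c≤d)) eq)
  +-mono-≤-equality {a = a} (inj₂ refl) (inj₁ c<d) eq = ⊥-elim (<⇒≢ (+-monoˡ-< a c<d) eq)
  +-mono-≤-equality (inj₂ refl) (inj₂ refl) eq = refl , refl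

  0<x⇒-x<0 : ∀ {x} → 0r < x → - x < 0r
  0<x⇒-x<0 {x} 0<x = subst₂ _<_ (+-idˡ (- x)) (+-inverseʳ x) (+-mono-< (- x) 0<x)

  x<0⇒0<-x : ∀ {x} → x < 0r → 0r < - x
  x<0⇒0<-x {x} x<0 = subst₂ _<_ (+-inverseʳ x) (+-idˡ (- x)) (+-mono-< (- x) x<0)

  0<y-x⇒x<y : ∀ {x y} → 0r < y + - x → x < y
  0<y-x⇒x<y {x} {y} 0<y-x = subst₂ _<_ (+-idˡ x) y-x+x≡y (+-mono-< x 0<y-x)
    where
    y-x+x≡y : y + - x + x ≡ y
    y-x+x≡y = trans (+-assoc y (- x) x) (trans (cong (y +_) (+-invˡ x)) (+-identityʳ y))

  0<1 : 0r < 1r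
  0<1 with <-tri 0r 1r
  ... | inj₁ 0<1        = 0<1
  ... | inj₂ (inj₁ 0≡1) = ⊥-elim (0≢1 0≡1)
  ... | inj₂ (inj₂ 1<0) = ⊥-elim (<⇒≱ 1<0 (inj₁ (subst (0r <_) -1*-1≡1 (*-pos 0<-1 0<-1))))
    where
    0<-1 : 0r < - 1r
    0<-1 = x<0⇒0<-x 1<0
    -1*-1≡1 : - 1r * - 1r ≡ 1r
    -1*-1≡1 = trans (sym (-‿distribˡ-* 1r (- 1r))) (trans (cong -_ (*-idˡ (- 1r))) (-‿involutive 1r))

  *-monoˡ-< : ∀ {c x y} → 0r < c → x < y → c * x < c * y
  *-monoˡ-< {c} {x} {y} 0<c x<y = 0<y-x⇒x<y (subst (0r <_)
    (trans (distribˡ c y (- x)) (cong (c * y +_) (sym (-‿distribʳ-* c x))))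
    (*-pos 0<c (subst₂ _<_ (+-inverseʳ x) refl (+-mono-< (- x) x<y))))

  *-monoˡ-≤ : ∀ {c x y} → 0r < c → x ≤ y → c * x ≤ c * y
  *-monoˡ-≤ 0<c (inj₁ x<y) = inj₁ (*-monoˡ-< 0<c x<y)
  *-monoˡ-≤ 0<c (inj₂ refl) = ≤-refl

  *-nonneg : ∀ {x y} → 0r ≤ x → 0r ≤ y → 0r ≤ x * y
  *-nonneg (inj₁ 0<x) (inj₁ 0<y) = inj₁ (*-pos 0<x 0<y)
  *-nonneg {y = y} (inj₂ refl) _ = inj₂ (sym (zeroˡ y))
  *-nonneg {x = x} (inj₁ _) (inj₂ refl) = inj₂ (sym (zeroʳ x))

  x≢0∧x*y≡0⇒y≡0 : ∀ {x y} → x ≢ 0r → x * y ≡ 0r → y ≡ 0r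
  x≢0∧x*y≡0⇒y≡0 {x} {y} x≢0 xy≡0 = begin
    y                  ≡⟨ sym (*-idˡ y) ⟩
    1r * y             ≡⟨ cong (_* y) (sym (*-invˡ x x≢0)) ⟩
    inv x x≢0 * x * y  ≡⟨ *-assoc (inv x x≢0) x y ⟩
    inv x x≢0 * (x * y) ≡⟨ cong (inv x x≢0 *_) xy≡0 ⟩
    inv x x≢0 * 0r     ≡⟨ zeroʳ (inv x x≢0) ⟩
    0r                 ∎
    where open ≡-Reasoning

  inv-pos : ∀ {x} (x≢0 : x ≢ 0r) → 0r < x → 0r < inv x x≢0
  inv-pos {x} x≢0 0<x with <-tri 0r (inv x x≢0)
  ... | inj₁ 0<x⁻¹        = 0<x⁻¹
  ... | inj₂ (inj₁ 0≡x⁻¹) = ⊥-elim (0≢1 (trans (sym (zeroˡ x)) (trans (cong (_* x) 0≡x⁻¹) (*-invˡ x x≢0))))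
  ... | inj₂ (inj₂ x⁻¹<0) = ⊥-elim (<⇒≱ (0<x⇒-x<0 0<1) (inj₁ 0<-1))
    where
    0<-1 : 0r < - 1r
    0<-1 = subst (0r <_) (trans (sym (-‿distribˡ-* (inv x x≢0) x)) (cong -_ (*-invˡ x x≢0)))
             (*-pos (x<0⇒0<-x x⁻¹<0) 0<x)

  2r : ℝ
  2r = 1r + 1r

  0<2 : 0r < 2r
  0<2 = <-trans 0<1 (subst (_< 2r) (+-idˡ 1r) (+-mono-< 1r 0<1))

  ½ : ℝ
  ½ = inv 2r (λ 2≡0 → <⇒≢ 0<2 (sym 2≡0))

  ½+½≡1 : ½ + ½ ≡ 1r
  ½+½≡1 = begin
    ½ + ½            ≡⟨ cong₂ _+_ (sym (*-idˡ ½)) (sym (*-idˡ ½)) ⟩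
    1r * ½ + 1r * ½  ≡⟨ sym (distribʳ ½ 1r 1r) ⟩
    2r * ½           ≡⟨ *-comm 2r ½ ⟩
    ½ * 2r           ≡⟨ *-invˡ 2r _ ⟩
    1r               ∎
    where open ≡-Reasoning

  1-½≡½ : 1r + - ½ ≡ ½
  1-½≡½ = begin
    1r + - ½      ≡⟨ cong (_+ - ½) (sym ½+½≡1) ⟩
    ½ + ½ + - ½   ≡⟨ +-assoc ½ ½ (- ½) ⟩
    ½ + (½ + - ½) ≡⟨ cong (½ +_) (+-inverseʳ ½) ⟩
    ½ + 0r        ≡⟨ +-identityʳ ½ ⟩
    ½             ∎
    where open ≡-Reasoning

  0<½ : 0r < ½
  0<½ = inv-pos _ 0<2

  ½<1 : ½ < 1r
  ½<1 = 0<y-x⇒x<y (subst (0r <_) (sym 1-½≡½) 0<½)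

module FiniteSums (R : RealField) where
  open RealField R renaming (_≤_ to infix 4 _≤_)
  open LP R
  open OrderedFieldProperties R

  sumF-cong : ∀ {k} {f g : Fin k → ℝ} → (∀ i → f i ≡ g i) → sumF f ≡ sumF g
  sumF-cong {zero}  f≗g = refl
  sumF-cong {suc k} f≗g = cong₂ _+_ (f≗g zero) (sumF-cong (λ i → f≗g (suc i)))

  sumF-zero : ∀ k → sumF {k} (λ _ → 0r) ≡ 0r
  sumF-zero zero    = refl
  sumF-zero (suc k) = trans (cong (0r +_) (sumF-zero k)) (+-idˡ 0r)

  sumF-+ : ∀ {k} (f g : Fin k → ℝ) → sumF (λ i → f i + g i) ≡ sumF f + sumF g
  sumF-+ {zero}  f g = sym (+-idˡ 0r)
  sumF-+ {suc k} f g = trans (cong (f zero + g zero +_) (sumF-+ (λ i → f (suc i)) (λ i → g (suc i))))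
    (solve 4 (λ a b c d → ((a ⊕ b) ⊕ (c ⊕ d)) ⊜ ((a ⊕ c) ⊕ (b ⊕ d))) refl _ _ _ _)

  sumF-*ˡ : ∀ {k} c (f : Fin k → ℝ) → sumF (λ i → c * f i) ≡ c * sumF f
  sumF-*ˡ {zero}  c f = sym (zeroʳ c)
  sumF-*ˡ {suc k} c f = trans (cong (c * f zero +_) (sumF-*ˡ c (λ i → f (suc i)))) (sym (distribˡ c _ _))

  sumF-comm : ∀ {k l} (f : Fin k → Fin l → ℝ) →
              sumF (λ i → sumF (λ j → f i j)) ≡ sumF (λ j → sumF (λ i → f i j))
  sumF-comm {zero}  {l} f = sym (sumF-zero l)
  sumF-comm {suc k} f = trans (cong (sumF (f zero) +_) (sumF-comm (λ i → f (suc i))))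
    (sym (sumF-+ (f zero) (λ j → sumF (λ i → f (suc i) j))))

  sumF-mono-≤ : ∀ {k} {f g : Fin k → ℝ} → (∀ i → f i ≤ g i) → sumF f ≤ sumF g
  sumF-mono-≤ {zero}  f≤g = ≤-refl
  sumF-mono-≤ {suc k} f≤g = +-mono-≤ (f≤g zero) (sumF-mono-≤ (λ i → f≤g (suc i)))

  sumF-mono-≤-equality : ∀ {k} {f g : Fin k → ℝ} → (∀ i → f i ≤ g i) → sumF f ≡ sumF g → ∀ i → f i ≡ g i
  sumF-mono-≤-equality {suc k} f≤g eq i
    with +-mono-≤-equality (f≤g zero) (sumF-mono-≤ (λ i → f≤g (suc i))) eq
  sumF-mono-≤-equality {suc k} f≤g eq zero    | head≡ , _ = head≡
  sumF-mono-≤-equality {suc k} f≤g eq (suc i) | _ , tail≡ = sumF-mono-≤-equality (λ i → f≤g (suc i)) tail≡ i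

  ·-linear : ∀ {k} (a x d : Vec k) t → a · (λ e → x e + t * d e) ≡ a · x + t * (a · d)
  ·-linear a x d t = begin
    sumF (λ e → a e * (x e + t * d e))
      ≡⟨ sumF-cong (λ e → solve 4 (λ a x t d → (a ⊗ (x ⊕ t ⊗ d)) ⊜ (a ⊗ x ⊕ t ⊗ (a ⊗ d))) refl (a e) (x e) t (d e)) ⟩
    sumF (λ e → a e * x e + t * (a e * d e))
      ≡⟨ sumF-+ (λ e → a e * x e) (λ e → t * (a e * d e)) ⟩
    a · x + sumF (λ e → t * (a e * d e))
      ≡⟨ cong (a · x +_) (sumF-*ˡ t (λ e → a e * d e)) ⟩
    a · x + t * (a · d)
      ∎
    where open ≡-Reasoning

  ·-sub : ∀ {k} (a x y : Vec k) → a · (λ e → x e + - y e) ≡ a · x + - (a · y)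
  ·-sub a x y = begin
    a · (λ e → x e + - y e)        ≡⟨ sumF-cong (λ e → cong (λ w → a e * (x e + w)) (sym (-1*x≈-x (y e)))) ⟩
    a · (λ e → x e + - 1r * y e)   ≡⟨ ·-linear a x y (- 1r) ⟩
    a · x + - 1r * (a · y)         ≡⟨ cong (a · x +_) (-1*x≈-x (a · y)) ⟩
    a · x + - (a · y)              ∎
    where open ≡-Reasoning

  ·-combination : ∀ {k l} (w : Fin l → ℝ) (Γ : Fin l → Vec k) (z ρ : Vec k) →
    (λ e → sumF (λ i → w i * Γ i e) + z e) · ρ ≡ sumF (λ i → w i * (Γ i · ρ)) + z · ρ
  ·-combination w Γ z ρ = begin
    sumF (λ e → (sumF (λ i → w i * Γ i e) + z e) * ρ e)
      ≡⟨ sumF-cong (λ e → distribʳ (ρ e) _ (z e)) ⟩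
    sumF (λ e → sumF (λ i → w i * Γ i e) * ρ e + z e * ρ e)
      ≡⟨ sumF-+ (λ e → sumF (λ i → w i * Γ i e) * ρ e) (λ e → z e * ρ e) ⟩
    sumF (λ e → sumF (λ i → w i * Γ i e) * ρ e) + z · ρ
      ≡⟨ cong (_+ z · ρ) (sumF-cong λ e →
           trans (*-comm _ (ρ e)) (sym (sumF-*ˡ (ρ e) (λ i → w i * Γ i e)))) ⟩
    sumF (λ e → sumF (λ i → ρ e * (w i * Γ i e))) + z · ρ
      ≡⟨ cong (_+ z · ρ) (sumF-comm (λ e i → ρ e * (w i * Γ i e))) ⟩
    sumF (λ i → sumF (λ e → ρ e * (w i * Γ i e))) + z · ρ
      ≡⟨ cong (_+ z · ρ) (sumF-cong λ i → trans
           (sumF-cong λ e → solve 3 (λ r w g → (r ⊗ (w ⊗ g)) ⊜ (w ⊗ (g ⊗ r))) refl (ρ e) (w i) (Γ i e))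
           (sumF-*ˡ (w i) (λ e → Γ i e * ρ e))) ⟩
    sumF (λ i → w i * (Γ i · ρ)) + z · ρ
      ∎
    where open ≡-Reasoning

  -- Defined through does, so that 𝟙[ suc j Fin.≟ suc e ] reduces to 𝟙[ j Fin.≟ e ].
  𝟙[_] : ∀ {p} {A : Set p} → Dec A → ℝ
  𝟙[ a? ] = if does a? then 1r else 0r

  𝟙-nonneg : ∀ {p} {A : Set p} (a? : Dec A) → 0r ≤ 𝟙[ a? ]
  𝟙-nonneg (yes _) = inj₁ 0<1
  𝟙-nonneg (no _)  = ≤-refl

  𝟙-yes : ∀ {p} {A : Set p} (a? : Dec A) → A → 𝟙[ a? ] ≡ 1r
  𝟙-yes (yes _) _ = refl
  𝟙-yes (no ¬a) a = ⊥-elim (¬a a)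

  𝟙[≟]*-mono-≤ : ∀ {x c y} → c ≤ y → 𝟙[ x ≟ c ] * x ≤ 𝟙[ x ≟ c ] * y
  𝟙[≟]*-mono-≤ {x} {c} {y} c≤y with x ≟ c
  ... | yes refl = subst₂ _≤_ (sym (*-idˡ x)) (sym (*-idˡ y)) c≤y
  ... | no _     = inj₂ (trans (zeroˡ x) (sym (zeroˡ y)))

  𝟙[≟]*-cancel : ∀ {x c y} → x ≡ c → 𝟙[ x ≟ c ] * x ≡ 𝟙[ x ≟ c ] * y → x ≡ y
  𝟙[≟]*-cancel {x} {c} {y} x≡c eq with x ≟ c
  ... | yes _  = trans (sym (*-idˡ x)) (trans eq (*-idˡ y))
  ... | no x≢c = ⊥-elim (x≢c x≡c)

  unit : ∀ {k} → Fin k → Vec k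
  unit j e = 𝟙[ j Fin.≟ e ]

  ·-unit : ∀ {k} (a : Vec k) j → a · unit j ≡ a j
  ·-unit {suc k} a zero = begin
    a zero * 1r + sumF (λ e → a (suc e) * 0r)  ≡⟨ cong₂ _+_ (*-identityʳ (a zero)) (sumF-cong λ e → zeroʳ (a (suc e))) ⟩
    a zero + sumF {k} (λ _ → 0r)              ≡⟨ cong (a zero +_) (sumF-zero k) ⟩
    a zero + 0r                               ≡⟨ +-identityʳ (a zero) ⟩
    a zero                                    ∎
    where open ≡-Reasoning
  ·-unit {suc k} a (suc j) =
    trans (cong₂ _+_ (zeroʳ (a zero)) (·-unit (λ e → a (suc e)) j)) (+-idˡ (a (suc j)))

module SmallPerturbations (R : RealField) where
  open RealField R renaming (_≤_ to infix 4 _≤_)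
  open OrderedFieldProperties R

  NearZero : (ℝ → Set) → Set
  NearZero P = ∃ λ β → 0r < β × (∀ ε → 0r < ε → ε ≤ β → P ε)

  nearZero-× : ∀ {P Q} → NearZero P → NearZero Q → NearZero (λ ε → P ε × Q ε)
  nearZero-× (β , 0<β , P↓) (β′ , 0<β′ , Q↓) with <-tri β β′
  ... | inj₁ β<β′ = β , 0<β , λ ε 0<ε ε≤β → P↓ ε 0<ε ε≤β , Q↓ ε 0<ε (≤-trans ε≤β (inj₁ β<β′))
  ... | inj₂ (inj₁ refl) = β , 0<β , λ ε 0<ε ε≤β → P↓ ε 0<ε ε≤β , Q↓ ε 0<ε ε≤β
  ... | inj₂ (inj₂ β′<β) = β′ , 0<β′ , λ ε 0<ε ε≤β′ → P↓ ε 0<ε (≤-trans ε≤β′ (inj₁ β′<β)) , Q↓ ε 0<ε ε≤β′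

  nearZero-∀ : ∀ {k} {P : Fin k → ℝ → Set} → (∀ i → NearZero (P i)) → NearZero (λ ε → ∀ i → P i ε)
  nearZero-∀ {zero} _ = 1r , 0<1 , λ _ _ _ ()
  nearZero-∀ {suc k} P↓ with nearZero-× (P↓ zero) (nearZero-∀ (λ i → P↓ (suc i)))
  ... | β , 0<β , both = β , 0<β , λ where
    ε 0<ε ε≤β zero    → proj₁ (both ε 0<ε ε≤β)
    ε 0<ε ε≤β (suc i) → proj₂ (both ε 0<ε ε≤β) i

  nearZero-map : ∀ {P Q : ℝ → Set} → (∀ ε → P ε → Q ε) → NearZero P → NearZero Q
  nearZero-map P⇒Q (β , 0<β , P↓) = β , 0<β , λ ε 0<ε ε≤β → P⇒Q ε (P↓ ε 0<ε ε≤β)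

  below-positive : ∀ x → ∃ λ A → 0r < A × x ≤ A
  below-positive x with <-tri 0r x
  ... | inj₁ 0<x        = x , 0<x , ≤-refl
  ... | inj₂ (inj₁ refl) = 1r , 0<1 , inj₁ 0<1
  ... | inj₂ (inj₂ x<0) = 1r , 0<1 , inj₁ (<-trans x<0 0<1)

  nearZero-slack : ∀ {a c} → c < a → ∀ b → NearZero (λ ε → c ≤ a + ε * b)
  nearZero-slack {a} {c} c<a b with below-positive (- b)
  ... | A , 0<A , -b≤A = β , 0<β , c≤a+εb
    where
    s : ℝ
    s = a + - c
    A≢0 : A ≢ 0r
    A≢0 A≡0 = <⇒≢ 0<A (sym A≡0)
    β : ℝ
    β = s * inv A A≢0
    0<β : 0r < β
    0<β = *-pos (subst₂ _<_ (+-inverseʳ c) refl (+-mono-< (- c) c<a)) (inv-pos A≢0 0<A)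
    βA≡s : β * A ≡ s
    βA≡s = trans (*-assoc s (inv A A≢0) A) (trans (cong (s *_) (*-invˡ A A≢0)) (*-identityʳ s))
    c≤a+εb : ∀ ε → 0r < ε → ε ≤ β → c ≤ a + ε * b
    c≤a+εb ε 0<ε ε≤β = subst₂ _≤_ cancel-εb cancel-c (+-monoʳ-≤ (c + ε * b) ε*-b≤s)
      where
      open ≡-Reasoning
      cancel-εb : ε * - b + (c + ε * b) ≡ c
      cancel-εb = begin
        ε * - b + (c + ε * b)   ≡⟨ solve 3 (λ u c v → (u ⊕ (c ⊕ v)) ⊜ (c ⊕ (u ⊕ v))) refl (ε * - b) c (ε * b) ⟩
        c + (ε * - b + ε * b)   ≡⟨ cong (c +_) (sym (distribˡ ε (- b) b)) ⟩
        c + ε * (- b + b)       ≡⟨ cong (λ w → c + ε * w) (+-invˡ b) ⟩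
        c + ε * 0r              ≡⟨ cong (c +_) (zeroʳ ε) ⟩
        c + 0r                  ≡⟨ +-identityʳ c ⟩
        c                       ∎
      cancel-c : s + (c + ε * b) ≡ a + ε * b
      cancel-c = begin
        a + - c + (c + ε * b)   ≡⟨ solve 4 (λ a u c v → ((a ⊕ u) ⊕ (c ⊕ v)) ⊜ ((a ⊕ v) ⊕ (u ⊕ c))) refl a (- c) c (ε * b) ⟩
        a + ε * b + (- c + c)   ≡⟨ cong (a + ε * b +_) (+-invˡ c) ⟩
        a + ε * b + 0r          ≡⟨ +-identityʳ (a + ε * b) ⟩
        a + ε * b               ∎
      ε*-b≤s : ε * - b ≤ s
      ε*-b≤s = ≤-trans (*-monoˡ-≤ 0<ε -b≤A) (subst₂ _≤_ (*-comm A ε) (trans (*-comm A β) βA≡s) (*-monoˡ-≤ 0<A ε≤β))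

  nearZero-± : ∀ {a b c} → c ≤ a → (a ≡ c → b ≡ 0r) →
               NearZero (λ ε → c ≤ a + ε * b × c ≤ a + - ε * b)
  nearZero-± {a} {b} (inj₁ c<a) _ =
    nearZero-× (nearZero-slack c<a b) (nearZero-map (λ ε → subst (λ w → _ ≤ a + w) (-ε*b≡ε*-b ε))
                                                    (nearZero-slack c<a (- b)))
    where
    -ε*b≡ε*-b : ∀ ε → ε * - b ≡ - ε * b
    -ε*b≡ε*-b ε = trans (sym (-‿distribʳ-* ε b)) (-‿distribˡ-* ε b)
  nearZero-± {a} {b} (inj₂ refl) a≡c⇒b≡0 = 1r , 0<1 , λ ε _ _ → a≤a+t*b ε , a≤a+t*b (- ε)
    where
    a≤a+t*b : ∀ t → a ≤ a + t * b
    a≤a+t*b t = inj₂ (sym (trans (cong (λ w → a + t * w) (a≡c⇒b≡0 refl))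
                           (trans (cong (a +_) (zeroʳ t)) (+-identityʳ a))))

module Extremality (R : RealField) {n m : ℕ} (Γ : Fin m → LP.Vec R n) where
  open RealField R renaming (_≤_ to infix 4 _≤_)
  open LP R
  open OrderedFieldProperties R
  open FiniteSums R
  open SmallPerturbations R

  TightDirection : Vec n → Vec n → Set
  TightDirection x d = (∀ i → Γ i · x ≡ 1r → Γ i · d ≡ 0r) × (∀ e → x e ≡ 0r → d e ≡ 0r)

  displace : Vec n → ℝ → Vec n → Vec n
  displace x t d e = x e + t * d e

  nearZero-displace-admissible : ∀ {x d} → Adm Γ x → TightDirection x d →
    NearZero (λ ε → Adm Γ (displace x ε d) × Adm Γ (displace x (- ε) d))
  nearZero-displace-admissible {x} {d} (x≥0 , x-feasible) (d⊥tight , d-supported) =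
    nearZero-map admissible
      (nearZero-× (nearZero-∀ (λ i → nearZero-± (x-feasible i) (d⊥tight i)))
                  (nearZero-∀ (λ e → nearZero-± (x≥0 e) (d-supported e))))
    where
    admissible : ∀ ε →
      (∀ i → 1r ≤ Γ i · x + ε * (Γ i · d) × 1r ≤ Γ i · x + - ε * (Γ i · d)) ×
      (∀ e → 0r ≤ x e + ε * d e × 0r ≤ x e + - ε * d e) →
      Adm Γ (displace x ε d) × Adm Γ (displace x (- ε) d)
    admissible ε (feasible± , nonneg±) =
      ((λ e → proj₁ (nonneg± e)) , λ i → subst (1r ≤_) (sym (·-linear (Γ i) x d ε)) (proj₁ (feasible± i))) ,
      ((λ e → proj₂ (nonneg± e)) , λ i → subst (1r ≤_) (sym (·-linear (Γ i) x d (- ε))) (proj₂ (feasible± i)))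

  extreme⇒tightDirection≐0 : ∀ {x d} → Extreme (Adm Γ) x → TightDirection x d → ∀ e → d e ≡ 0r
  extreme⇒tightDirection≐0 {x} {d} (x-adm , x-extreme) d-tight e
    with nearZero-displace-admissible x-adm d-tight
  ... | ε , 0<ε , admissible± = x≢0∧x*y≡0⇒y≡0 2ε≢0 2εd≡0
    where
    open ≡-Reasoning
    x⁺ x⁻ : Vec n
    x⁺ = displace x ε d
    x⁻ = displace x (- ε) d

    εy-εy≡0 : ∀ y → ε * y + - ε * y ≡ 0r
    εy-εy≡0 y = trans (sym (distribʳ y ε (- ε))) (trans (cong (_* y) (+-inverseʳ ε)) (zeroˡ y))

    midpoint : x ≐ comb ½ x⁺ x⁻
    midpoint e = sym (begin
      ½ * (x e + ε * d e) + (1r + - ½) * (x e + - ε * d e)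
        ≡⟨ cong (λ w → ½ * (x e + ε * d e) + w * (x e + - ε * d e)) 1-½≡½ ⟩
      ½ * (x e + ε * d e) + ½ * (x e + - ε * d e)
        ≡⟨ solve 4 (λ h y u v → (h ⊗ (y ⊕ u) ⊕ h ⊗ (y ⊕ v)) ⊜ ((h ⊗ y ⊕ h ⊗ y) ⊕ h ⊗ (u ⊕ v)))
                 refl ½ (x e) (ε * d e) (- ε * d e) ⟩
      (½ * x e + ½ * x e) + ½ * (ε * d e + - ε * d e)
        ≡⟨ cong (_+ ½ * (ε * d e + - ε * d e)) (sym (distribʳ (x e) ½ ½)) ⟩
      (½ + ½) * x e + ½ * (ε * d e + - ε * d e)
        ≡⟨ cong₂ (λ s t → s * x e + ½ * t) ½+½≡1 (εy-εy≡0 (d e)) ⟩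
      1r * x e + ½ * 0r
        ≡⟨ cong₂ _+_ (*-idˡ (x e)) (zeroʳ ½) ⟩
      x e + 0r
        ≡⟨ +-identityʳ (x e) ⟩
      x e ∎)

    x⁺≐x⁻ : x⁺ ≐ x⁻
    x⁺≐x⁻ = x-extreme x⁺ x⁻ ½ (proj₁ (admissible± ε 0<ε ≤-refl)) (proj₂ (admissible± ε 0<ε ≤-refl))
                      0<½ ½<1 midpoint

    2ε≢0 : ε + ε ≢ 0r
    2ε≢0 2ε≡0 = <⇒≢ (<-trans 0<ε (subst (_< ε + ε) (+-idˡ ε) (+-mono-< ε 0<ε))) (sym 2ε≡0)

    2εd≡0 : (ε + ε) * d e ≡ 0r
    2εd≡0 = begin
      (ε + ε) * d e          ≡⟨ distribʳ (d e) ε ε ⟩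
      ε * d e + ε * d e      ≡⟨ cong (ε * d e +_) (+-cancelˡ (x e) _ _ (x⁺≐x⁻ e)) ⟩
      ε * d e + - ε * d e    ≡⟨ εy-εy≡0 (d e) ⟩
      0r                     ∎

module BlockerWeights (R : RealField) {n m : ℕ} (Γ : Fin m → LP.Vec R n) (γ̂ : LP.Vec R n) where
  open RealField R renaming (_≤_ to infix 4 _≤_)
  open LP R
  open OrderedFieldProperties R
  open FiniteSums R
  open Extremality R Γ

  tight? : (i : Fin m) → Dec (Γ i · γ̂ ≡ 1r)
  tight? i = Γ i · γ̂ ≟ 1r

  vanishes? : (e : Fin n) → Dec (γ̂ e ≡ 0r)
  vanishes? e = γ̂ e ≟ 0r

  σ : Vec n
  σ e = sumF (λ i → 𝟙[ tight? i ] * Γ i e) + 𝟙[ vanishes? e ]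

  σ·-expansion : ∀ ρ → σ · ρ ≡ sumF (λ i → 𝟙[ tight? i ] * (Γ i · ρ)) + sumF (λ e → 𝟙[ vanishes? e ] * ρ e)
  σ·-expansion = ·-combination (λ i → 𝟙[ tight? i ]) Γ (λ e → 𝟙[ vanishes? e ])

  module _ {ρ : Vec n} (ρ-adm : Adm Γ ρ) where
    private
      tight-terms-≤ : ∀ i → 𝟙[ tight? i ] * (Γ i · γ̂) ≤ 𝟙[ tight? i ] * (Γ i · ρ)
      tight-terms-≤ i = 𝟙[≟]*-mono-≤ (proj₂ ρ-adm i)

      vanishing-terms-≤ : ∀ e → 𝟙[ vanishes? e ] * γ̂ e ≤ 𝟙[ vanishes? e ] * ρ e
      vanishing-terms-≤ e = 𝟙[≟]*-mono-≤ (proj₁ ρ-adm e)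

      expansion-≤ : sumF (λ i → 𝟙[ tight? i ] * (Γ i · γ̂)) + sumF (λ e → 𝟙[ vanishes? e ] * γ̂ e)
                  ≤ sumF (λ i → 𝟙[ tight? i ] * (Γ i · ρ)) + sumF (λ e → 𝟙[ vanishes? e ] * ρ e)
      expansion-≤ = +-mono-≤ (sumF-mono-≤ tight-terms-≤) (sumF-mono-≤ vanishing-terms-≤)

    σ-minimal : σ · γ̂ ≤ σ · ρ
    σ-minimal = subst₂ _≤_ (sym (σ·-expansion γ̂)) (sym (σ·-expansion ρ)) expansion-≤

    σ-optimal⇒tightDirection : σ · ρ ≤ σ · γ̂ → TightDirection γ̂ (λ e → ρ e + - γ̂ e)
    σ-optimal⇒tightDirection σρ≤σγ̂ =
      (λ i γ̂-tight → trans (·-sub (Γ i) ρ γ̂) (x≡y⇒x-y≡0 (sym (𝟙[≟]*-cancel γ̂-tight (tight-equal i))))) ,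
      (λ e γ̂e≡0 → x≡y⇒x-y≡0 (sym (𝟙[≟]*-cancel γ̂e≡0 (vanishing-equal e))))
      where
      x≡y⇒x-y≡0 : ∀ {x y} → x ≡ y → x + - y ≡ 0r
      x≡y⇒x-y≡0 {y = y} refl = +-inverseʳ y


      sums-equal : sumF (λ i → 𝟙[ tight? i ] * (Γ i · γ̂)) ≡ sumF (λ i → 𝟙[ tight? i ] * (Γ i · ρ))
                 × sumF (λ e → 𝟙[ vanishes? e ] * γ̂ e) ≡ sumF (λ e → 𝟙[ vanishes? e ] * ρ e)
      sums-equal = +-mono-≤-equality (sumF-mono-≤ tight-terms-≤) (sumF-mono-≤ vanishing-terms-≤)
        (trans (sym (σ·-expansion γ̂)) (trans (≤-antisym σ-minimal σρ≤σγ̂) (σ·-expansion ρ)))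

      tight-equal : ∀ i → 𝟙[ tight? i ] * (Γ i · γ̂) ≡ 𝟙[ tight? i ] * (Γ i · ρ)
      tight-equal = sumF-mono-≤-equality tight-terms-≤ (proj₁ sums-equal)

      vanishing-equal : ∀ e → 𝟙[ vanishes? e ] * γ̂ e ≡ 𝟙[ vanishes? e ] * ρ e
      vanishing-equal = sumF-mono-≤-equality vanishing-terms-≤ (proj₂ sums-equal)

  module _ (Γ≥0 : ∀ i → Nonneg (Γ i)) where
    private
      tight-terms-nonneg : ∀ j i → 0r ≤ 𝟙[ tight? i ] * Γ i j
      tight-terms-nonneg j i = *-nonneg (𝟙-nonneg (tight? i)) (Γ≥0 i j)

      σ-split-≤ : ∀ j → sumF {m} (λ _ → 0r) + 0r ≤ σ j
      σ-split-≤ j = +-mono-≤ (sumF-mono-≤ (tight-terms-nonneg j)) (𝟙-nonneg (vanishes? j))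

      0+0≡0 : sumF {m} (λ _ → 0r) + 0r ≡ 0r
      0+0≡0 = trans (+-identityʳ _) (sumF-zero m)

    σ-nonneg : Nonneg σ
    σ-nonneg j = subst (_≤ σ j) 0+0≡0 (σ-split-≤ j)

    σ≡0⇒tightDirection : ∀ j → σ j ≡ 0r → TightDirection γ̂ (unit j)
    σ≡0⇒tightDirection j σj≡0 = unit-⊥-tight , unit-supported
      where
      parts-zero : sumF {m} (λ _ → 0r) ≡ sumF (λ i → 𝟙[ tight? i ] * Γ i j) × 0r ≡ 𝟙[ vanishes? j ]
      parts-zero = +-mono-≤-equality (sumF-mono-≤ (tight-terms-nonneg j)) (𝟙-nonneg (vanishes? j))
                     (trans 0+0≡0 (sym σj≡0))

      unit-⊥-tight : ∀ i → Γ i · γ̂ ≡ 1r → Γ i · unit j ≡ 0r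
      unit-⊥-tight i γ̂-tight = begin
        Γ i · unit j              ≡⟨ ·-unit (Γ i) j ⟩
        Γ i j                     ≡⟨ sym (*-idˡ (Γ i j)) ⟩
        1r * Γ i j                ≡⟨ cong (_* Γ i j) (sym (𝟙-yes (tight? i) γ̂-tight)) ⟩
        𝟙[ tight? i ] * Γ i j     ≡⟨ sym (sumF-mono-≤-equality (tight-terms-nonneg j) (proj₁ parts-zero) i) ⟩
        0r                        ∎
        where open ≡-Reasoning

      unit-supported : ∀ e → γ̂ e ≡ 0r → unit j e ≡ 0r
      unit-supported e γ̂e≡0 with j Fin.≟ e
      ... | yes refl = ⊥-elim (0≢1 (trans (proj₂ parts-zero) (𝟙-yes (vanishes? j) γ̂e≡0)))
      ... | no _     = refl

  module _ (γ̂-extreme : InBlocker Γ γ̂) where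

    σ-uniquely-minimal : ∀ {ρ} → Adm Γ ρ → σ · ρ ≤ σ · γ̂ → ρ ≐ γ̂
    σ-uniquely-minimal ρ-adm σρ≤σγ̂ e =
      x-y≡0⇒x≡y _ _ (extreme⇒tightDirection≐0 γ̂-extreme (σ-optimal⇒tightDirection ρ-adm σρ≤σγ̂) e)

    σ-positive : (∀ i → Nonneg (Γ i)) → Positive σ
    σ-positive Γ≥0 j with <-tri 0r (σ j)
    ... | inj₁ 0<σj        = 0<σj
    ... | inj₂ (inj₂ σj<0) = ⊥-elim (<⇒≱ σj<0 (σ-nonneg Γ≥0 j))
    ... | inj₂ (inj₁ 0≡σj) = ⊥-elim (0≢1 (trans (sym unit-j-j≡0) (𝟙-yes (j Fin.≟ j) refl)))
      where
      unit-j-j≡0 : unit j j ≡ 0r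
      unit-j-j≡0 = extreme⇒tightDirection≐0 γ̂-extreme (σ≡0⇒tightDirection Γ≥0 j (sym 0≡σj)) j

mainTheorem12 : (R : RealField) → let open RealField R in let open LP R in
    (n m : ℕ) (Γ : Fin (suc m) → Vec n) →
    (∀ i → Nonneg (Γ i)) →
    (∀ i → ∃ λ e → 0r < Γ i e) →
    (γ̂ : Vec n) → InBlocker Γ γ̂ →
    ∃ λ (σ : Vec n) → Positive σ ×
      (((∀ ρ → Adm Γ ρ → (σ · γ̂) ≤ (σ · ρ)) ×
        (∀ ρ → Adm Γ ρ → (σ · ρ) ≤ (σ · γ̂) → ρ ≐ γ̂)) ×
       ((∀ γ → InBlocker Γ γ → (σ · γ̂) ≤ (σ · γ)) ×
        (∀ γ → InBlocker Γ γ → (σ · γ) ≤ (σ · γ̂) → γ ≐ γ̂)))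
mainTheorem12 R n m Γ Γ≥0 _ γ̂ γ̂-extreme =
  σ , σ-positive γ̂-extreme Γ≥0 ,
  ((λ ρ → σ-minimal) , (λ ρ → σ-uniquely-minimal γ̂-extreme)) ,
  ((λ γ γ-extreme → σ-minimal (proj₁ γ-extreme)) ,
   (λ γ γ-extreme → σ-uniquely-minimal γ̂-extreme (proj₁ γ-extreme)))
  where open BlockerWeights R Γ γ̂
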